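{- Let $\diamond$ be one of the unary operations minimal hitting set ($\mathcal{F}\mapsto\mathcal{F}^\sharp$) or closure ($\mathcal{F}\mapsto\mathcal{F}^\cap$). Then there exist, for each positive integer $m$, a finite ground set $U_m$ with $|U_m|=O(m^2)$, a total order $<_m$ on $U_m$, and a family $\mathcal{F}_m$ of subsets of $U_m$ such that $Z_{<_m}(\mathcal{F}_m)=O(m^4)$ and $Z_{<_m}(\mathcal{F}_m^\diamond)=\Omega(2^{m}/\mathrm{poly}(m))$, i.e. $Z_{<_m}(\mathcal{F}_m^\diamond)\ge 2^m/p(m)$ for some polynomial $p$ and all sufficiently large $m$.
   Context: A family of sets is a set of subsets of a finite ground set $U$. For a family $\mathcal{A}$, $\mathcal{A}^\downarrow=\{A\in\mathcal{A}\mid\forall A'\in\mathcal{A}: A'\subseteq A\Rightarrow A=A'\}$. Minimal hitting set: $\mathcal{F}^\sharp=\{S\subseteq U\mid \forall F\in\mathcal{F}: S\cap F\neq\emptyset\}^\downarrow$. Closure: $\mathcal{F}^\cap=\{\bigcap_{S\in\mathcal{F}'}S\mid \mathcal{F}'\subseteq\mathcal{F}\}$. A zero-suppressed binary decision diagram (ZDD) with respect to a total order $<$ on $U$ is a rooted DAG with two terminal nodes $\top,\bot$ and internal nodes $\mathtt{n}$, each with a label $\mathsf{lb}(\mathtt{n})\in U$ and children $\mathsf{lo}(\mathtt{n}),\mathsf{hi}(\mathtt{n})$, labels strictly increasing along arcs. A node represents: $\{\emptyset\}$ if $\top$, $\emptyset$ if $\bot$, and $\mathcal{F}_{\mathsf{lo}(\mathtt{n})}\cup\{\{\mathsf{lb}(\mathtt{n})\}\cup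 S\mid S\in\mathcal{F}_{\mathsf{hi}(\mathtt{n})}\}$ otherwise; the ZDD represents the family of its root. The reduced ZDD (obtained by merging nodes with identical label and children and deleting nodes whose hi-child is $\bot$) is the unique smallest ZDD for the family and order; $Z_<(\mathcal{F})$ is its number of nodes. Asymptotics are as $m\to\infty$. -}

module Defs where

open import Data.Nat using (ℕ; suc; _+_; _*_; _^_; _≤_)
open import Data.Fin using (Fin) renaming (_<_ to _<ᶠ_)
open import Data.Fin.Subset using (Subset; Nonempty; _∩_; _∪_; _⊆_; ⁅_⁆) renaming (⊤ to Full; ⊥ to Empty)
open import Data.List using (List; foldr)
open import Data.List.Relation.Unary.All using (All)
open import Data.Product using (Σ; ∃; _×_; _,_)
open import Relation.Binary.PropositionalEquality using (_≡_)
open import Function.Bundles using (_⇔_)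

-- Ground set U = Fin n, totally ordered by the natural order on Fin n.
-- A family of subsets of U, given as a predicate on subsets.
Fam : ℕ → Set₁
Fam n = Subset n → Set

Hits : ∀ {n} → Fam n → Subset n → Set
Hits F S = ∀ T → F T → Nonempty (S ∩ T)

Minimal : ∀ {n} → Fam n → Fam n
Minimal A S = A S × (∀ S' → A S' → S' ⊆ S → S ≡ S')

MinHit : ∀ {n} → Fam n → Fam n
MinHit F = Minimal (Hits F)

-- Closure  F^∩ : intersections of (finite) subfamilies of F;
-- the empty subfamily has intersection U.

Closure : ∀ {n} → Fam n → Fam n
Closure F S = Σ (List (Subset _)) λ L → All F L × S ≡ foldr _∩_ Full L

data Op : Set where
  sharp closure : Op

apply : Op → ∀ {n} → Fam n → Fam n
apply sharp   = MinHit
apply closure = Closure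

-- ZDDs over Fin n w.r.t. the natural order on Fin n.
-- k internal nodes, indexed by Fin k; pointers go to ⊥, ⊤ or an internal node.

data Ptr (k : ℕ) : Set where
  bot top : Ptr k
  node    : Fin k → Ptr k

record ZDD (n : ℕ) : Set where
  field
    k     : ℕ
    lb    : Fin k → Fin n
    lo hi : Fin k → Ptr k
    root  : Ptr k
    lo-ord : ∀ j i → lo j ≡ node i → lb j <ᶠ lb i
    hi-ord : ∀ j i → hi j ≡ node i → lb j <ᶠ lb i

open ZDD public

-- Number of nodes: internal nodes plus the two terminals.
size : ∀ {n} → ZDD n → ℕ
size D = k D + 2

data Mem {n} (D : ZDD n) : Ptr (k D) → Subset n → Set where
  mem-top : Mem D top Empty
  mem-lo  : ∀ {j S} → Mem D (lo D j) S → Mem D (node j) S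
  mem-hi  : ∀ {j S} → Mem D (hi D j) S → Mem D (node j) (⁅ lb D j ⁆ ∪ S)

Represents : ∀ {n} → ZDD n → Fam n → Set
Represents D F = ∀ S → Mem D (root D) S ⇔ F S

-- The ground set is X₀ < … < X_{m-1} < Y₀ < … < Y_{m-1}, i.e. Fin (m + m) with subsets u ++ v, where
-- u collects the X's and v the Y's.  F_m consists of the pairs {X_j , Y_j} (for ♯) or of their
-- complements (for ∩); a family of k sets over n points has a trie-shaped ZDD with k·n + 2 nodes,
-- so Z(F_m) = O(m²).
-- Lower bound: a root-to-⊤ path of a ZDD has consumed exactly the first-half part of its set when
-- it crosses into labels ≥ m, and two sets whose paths cross at the same node can exchange their
-- second halves.  For ♯ the minimal hitting sets a ++ ∁ a, and for ∩ the intersections a ++ a, form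
-- a fooling set: no exchange a' ++ g a with a' ≠ a stays in the family, so the 2^m choices of a
-- need 2^m distinct crossing nodes.
module Submission where

open import Defs
open import Data.Nat using (ℕ; zero; suc; _+_; _*_; _^_; _≤_; _<_; z≤n; s≤s; _<?_)
open import Data.Nat.Properties
  using ( ≤-refl; ≤-trans; ≤-reflexive; <⇒≤; <-≤-trans; ≤-<-trans; <-irrefl; ≮⇒≥; ≤∧≢⇒<
        ; n≤1+n; m≤m+n; m≤n⇒m<n∨m≡n; m<1+n⇒m<n∨m≡n; +-comm; +-suc; +-identityʳ; *-identityʳ
        ; +-mono-≤; *-monoʳ-≤; ^-monoʳ-≤; module ≤-Reasoning)
open import Data.Nat.Tactic.RingSolver using (solve-∀)
open import Data.Bool as Bool using (Bool; true; false)
open import Data.Empty using (⊥; ⊥-elim)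
open import Data.Unit using (⊤; tt)
open import Data.Fin as Fin using (Fin; toℕ; fromℕ<; _↑ˡ_; _↑ʳ_; finToFun; funToFin; combine; remQuot)
open import Data.Fin.Properties
  using ( toℕ-↑ˡ; toℕ-↑ʳ; toℕ<n; toℕ-fromℕ<; toℕ-injective; injective⇒≤; funToFin-finToFin
        ; remQuot-combine; any?; all?)
open import Data.Fin.Subset
  using (Subset; _∈_; _∉_; _⊆_; _∪_; _∩_; _-_; ∁; ⋂; ⁅_⁆; Nonempty; Empty)
  renaming (⊤ to ⊤ₛ; ⊥ to ∅)
open import Data.Fin.Subset.Properties
  using ( _∈?_; ∉⊥; ∈⊤; x∈⁅x⁆; x∈⁅y⁆⇒x≡y; x≢y⇒x∉⁅y⁆; x∉p⇒x∈∁p; x∈∁p⇒x∉p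
        ; x∈p∩q⁺; x∈p∩q⁻; x∈p∪q⁺; x∈p∪q⁻; x∈p∧x≢y⇒x∈p-y; p─q⊆p; drop-∷-⊆
        ; ⊆-refl; ⊆-antisym; Empty-unique; ∪-identityˡ; ∪-identityʳ; ∪-assoc)
open import Data.Vec using ([]; _∷_; _++_; replicate; splitAt; tabulate; lookup; here; there)
open import Data.Vec.Properties
  using (zipWith-++; ++-injective; ++-injectiveˡ; lookup∘tabulate; []=⇒lookup; lookup⇒[]=)
open import Data.List using (List; map; filter; allFin)
open import Data.List.Membership.Propositional.Properties using (∈-filter⁺; ∈-allFin)
open import Data.List.Relation.Unary.All as All using (All)
open import Data.List.Relation.Unary.All.Properties using (map⁺; map⁻; all-filter)
open import Data.Product as Product using (Σ; ∃; _×_; _,_; proj₁; proj₂)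
open import Data.Sum as Sum using (_⊎_; inj₁; inj₂)
open import Function.Base using (_∘_)
open import Function.Bundles using (Equivalence; _⇔_; mk⇔)
open import Function.Definitions using (Injective)
open import Relation.Nullary using (Dec; yes; no; ¬_; ¬?)
open import Relation.Nullary.Decidable using (_×-dec_; _→-dec_; decidable-stable)
open import Relation.Binary.PropositionalEquality
  using (_≡_; refl; sym; trans; cong; cong₂; subst; subst₂; _≗_; module ≡-Reasoning)

-- Subsets of Fin (s + t) as u ++ v

∈-++⁺ˡ : ∀ {s t} {i : Fin s} {u : Subset s} (v : Subset t) → i ∈ u → i ↑ˡ t ∈ u ++ v
∈-++⁺ˡ v here        = here
∈-++⁺ˡ v (there i∈u) = there (∈-++⁺ˡ v i∈u)

∈-++⁻ˡ : ∀ {s t} {i : Fin s} (u : Subset s) {v : Subset t} → i ↑ˡ t ∈ u ++ v → i ∈ u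
∈-++⁻ˡ {i = Fin.zero}  (_ ∷ u) here        = here
∈-++⁻ˡ {i = Fin.suc i} (_ ∷ u) (there i∈u) = there (∈-++⁻ˡ u i∈u)

∈-++⁺ʳ : ∀ {s t} (u : Subset s) {v : Subset t} {i : Fin t} → i ∈ v → s ↑ʳ i ∈ u ++ v
∈-++⁺ʳ []      i∈v = i∈v
∈-++⁺ʳ (_ ∷ u) i∈v = there (∈-++⁺ʳ u i∈v)

∈-++⁻ʳ : ∀ {s t} (u : Subset s) {v : Subset t} {i : Fin t} → s ↑ʳ i ∈ u ++ v → i ∈ v
∈-++⁻ʳ []      i∈v         = i∈v
∈-++⁻ʳ (_ ∷ u) (there i∈v) = ∈-++⁻ʳ u i∈v

⊆-++⁺ : ∀ {s t} {u u' : Subset s} {v v' : Subset t} → u ⊆ u' → v ⊆ v' → u ++ v ⊆ u' ++ v'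
⊆-++⁺ {u = []}    {[]}    _    v⊆v' x∈v = v⊆v' x∈v
⊆-++⁺ {u = _ ∷ _} {_ ∷ _} u⊆u' v⊆v' here with u⊆u' here
... | here = here
⊆-++⁺ {u = _ ∷ _} {_ ∷ _} u⊆u' v⊆v' (there x∈u++v) = there (⊆-++⁺ (drop-∷-⊆ u⊆u') v⊆v' x∈u++v)

⊆-++⁻ : ∀ {s t} {u u' : Subset s} {v v' : Subset t} → u ++ v ⊆ u' ++ v' → u ⊆ u' × v ⊆ v'
⊆-++⁻ {u = u} {u'} {v} sub =
  (λ i∈u → ∈-++⁻ˡ u' (sub (∈-++⁺ˡ v i∈u))) , (λ i∈v → ∈-++⁻ʳ u' (sub (∈-++⁺ʳ u i∈v)))

Nonempty-++⁻ : ∀ {s t} (u : Subset s) {v : Subset t} → Nonempty (u ++ v) → Nonempty u ⊎ Nonempty v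
Nonempty-++⁻ []          ne                    = inj₂ ne
Nonempty-++⁻ (true ∷ u)  _                     = inj₁ (Fin.zero , here)
Nonempty-++⁻ (false ∷ u) (Fin.suc x , there m) =
  Sum.map₁ (λ (y , y∈u) → Fin.suc y , there y∈u) (Nonempty-++⁻ u (x , m))

replicate-++ : ∀ {A : Set} s {t} (a : A) → replicate (s + t) a ≡ replicate s a ++ replicate t a
replicate-++ zero    a = refl
replicate-++ (suc s) a = cong (a ∷_) (replicate-++ s a)

∪-++ : ∀ {s t} (u u' : Subset s) (v v' : Subset t) → (u ++ v) ∪ (u' ++ v') ≡ (u ∪ u') ++ (v ∪ v')
∪-++ u u' v v' = zipWith-++ _ u v u' v'

∩-++ : ∀ {s t} (u u' : Subset s) (v v' : Subset t) → (u ++ v) ∩ (u' ++ v') ≡ (u ∩ u') ++ (v ∩ v')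
∩-++ u u' v v' = zipWith-++ _ u v u' v'

++∅-∪-∅++ : ∀ {s t} (u : Subset s) (v : Subset t) → (u ++ ∅) ∪ (∅ ++ v) ≡ u ++ v
++∅-∪-∅++ u v = trans (∪-++ u ∅ ∅ v) (cong₂ _++_ (∪-identityʳ u) (∪-identityˡ v))

below⇒++∅ : ∀ {s t} (u : Subset s) (v : Subset t) → (∀ x → x ∈ u ++ v → toℕ x < s) → v ≡ ∅
below⇒++∅ {s} u v below = Empty-unique λ (i , i∈v) →
  <-irrefl refl (<-≤-trans (below _ (∈-++⁺ʳ u i∈v))
                           (≤-trans (m≤m+n s _) (≤-reflexive (sym (toℕ-↑ʳ s i)))))

above⇒∅++ : ∀ {s t} (u : Subset s) (v : Subset t) → (∀ x → x ∈ u ++ v → s ≤ toℕ x) → u ≡ ∅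
above⇒∅++ {s} {t} u v above = Empty-unique λ (i , i∈u) →
  <-irrefl refl (<-≤-trans (subst (_< s) (sym (toℕ-↑ˡ i t)) (toℕ<n i)) (above _ (∈-++⁺ˡ v i∈u)))

prefix-suffix-++ : ∀ {s t} (P R : Subset (s + t)) {u : Subset s} {v : Subset t} →
  u ++ v ≡ P ∪ R → (∀ x → x ∈ P → toℕ x < s) → (∀ x → x ∈ R → s ≤ toℕ x) →
  P ≡ u ++ ∅ × R ≡ ∅ ++ v
prefix-suffix-++ {s} P R {u} u++v≡P∪R below above with splitAt s P | splitAt s R
... | p , p' , refl | r , r' , refl with below⇒++∅ p p' below | above⇒∅++ r r' above
... | refl | refl with ++-injective u p (trans u++v≡P∪R (++∅-∪-∅++ p r'))
... | refl , refl = refl , refl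

x∉p-x : ∀ {n} (p : Subset n) (x : Fin n) → x ∉ p - x
x∉p-x (true ∷ _)  Fin.zero    ()
x∉p-x (false ∷ _) Fin.zero    ()
x∉p-x (_ ∷ p)     (Fin.suc x) (there x∈p-x) = x∉p-x p x x∈p-x

⁅x⁆∪[p-x]≡p : ∀ {n} {x : Fin n} {p : Subset n} → x ∈ p → ⁅ x ⁆ ∪ (p - x) ≡ p
⁅x⁆∪[p-x]≡p {x = x} {p} x∈p = ⊆-antisym ⊆p p⊆
  where
  ⊆p : ⁅ x ⁆ ∪ (p - x) ⊆ p
  ⊆p y∈ with x∈p∪q⁻ ⁅ x ⁆ (p - x) y∈
  ... | inj₁ y∈⁅x⁆ = subst (_∈ p) (sym (x∈⁅y⁆⇒x≡y x y∈⁅x⁆)) x∈p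
  ... | inj₂ y∈p-x = p─q⊆p p ⁅ x ⁆ y∈p-x
  p⊆ : p ⊆ ⁅ x ⁆ ∪ (p - x)
  p⊆ {y} y∈p with y Fin.≟ x
  ... | yes refl = x∈p∪q⁺ (inj₁ (x∈⁅x⁆ x))
  ... | no  y≢x  = x∈p∪q⁺ (inj₂ (x∈p∧x≢y⇒x∈p-y y∈p y≢x))

lookup-∉ : ∀ {n} {S : Subset n} {x} → lookup S x ≡ false → x ∉ S
lookup-∉ x∉S x∈S with () ← trans (sym ([]=⇒lookup x∈S)) x∉S

Nonempty-∩⁅⁆ : ∀ {n} {u : Subset n} {j} → Nonempty (u ∩ ⁅ j ⁆) → j ∈ u
Nonempty-∩⁅⁆ {u = u} {j} (x , x∈) =
  let x∈u , x∈⁅j⁆ = x∈p∩q⁻ u ⁅ j ⁆ x∈ in subst (_∈ u) (x∈⁅y⁆⇒x≡y j x∈⁅j⁆) x∈u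

∈-⋂⁺ : ∀ {n} {x : Fin n} {L : List (Subset n)} → All (x ∈_) L → x ∈ ⋂ L
∈-⋂⁺ All.[]           = ∈⊤
∈-⋂⁺ (x∈A All.∷ x∈As) = x∈p∩q⁺ (x∈A , ∈-⋂⁺ x∈As)

∈-⋂⁻ : ∀ {n} {x : Fin n} (L : List (Subset n)) → x ∈ ⋂ L → All (x ∈_) L
∈-⋂⁻ List.[]      _   = All.[]
∈-⋂⁻ (A List.∷ L) x∈⋂ = let x∈A , x∈⋂L = x∈p∩q⁻ A (⋂ L) x∈⋂ in
                        x∈A All.∷ ∈-⋂⁻ L x∈⋂L

closure-induction : ∀ {n} {F : Fam n} (P : Subset n → Set) →
  P ⊤ₛ → (∀ {A B} → P A → P B → P (A ∩ B)) → (∀ {S} → F S → P S) →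
  ∀ {S} → Closure F S → P S
closure-induction {F = F} P P⊤ P∩ PF (_ , FL , refl) = go FL
  where
  go : ∀ {L} → All F L → P (⋂ L)
  go All.[]          = P⊤
  go (FA All.∷ FL') = P∩ (PF FA) (go FL')

-- Paths in a ZDD and the fooling-set bound

module Paths {n : ℕ} (D : ZDD n) where

  data Path : Ptr (k D) → Ptr (k D) → Subset n → Set where
    here    : ∀ {p} → Path p p ∅
    lo-step : ∀ {j q P} → Path (lo D j) q P → Path (node j) q P
    hi-step : ∀ {j q P} → Path (hi D j) q P → Path (node j) q (⁅ lb D j ⁆ ∪ P)

  glue : ∀ {p q P R} → Path p q P → Mem D q R → Mem D p (P ∪ R)
  glue {R = R} here m = subst (Mem D _) (sym (∪-identityˡ R)) m
  glue (lo-step path) m = mem-lo (glue path m)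
  glue {R = R} (hi-step {j} {P = P} path) m = subst (Mem D _) (sym (∪-assoc ⁅ lb D j ⁆ P R)) (mem-hi (glue path m))

  LabelsFrom : ℕ → Ptr (k D) → Set
  LabelsFrom v (node j) = v ≤ toℕ (lb D j)
  LabelsFrom v _        = ⊤

  LabelsFrom-child : ∀ {v j} (c : Ptr (k D)) → (∀ i → c ≡ node i → lb D j Fin.< lb D i) →
                     LabelsFrom v (node j) → LabelsFrom v c
  LabelsFrom-child (node i) ordered v≤j = ≤-trans v≤j (<⇒≤ (ordered i refl))
  LabelsFrom-child top      _       _   = tt
  LabelsFrom-child bot      _       _   = tt

  support : ∀ {v p S x} → Mem D p S → LabelsFrom v p → x ∈ S → v ≤ toℕ x
  support mem-top _ x∈∅ = ⊥-elim (∉⊥ x∈∅)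
  support (mem-lo {j} m) v≤j x∈S = support m (LabelsFrom-child (lo D j) (lo-ord D j) v≤j) x∈S
  support (mem-hi {j} {S} m) v≤j x∈S with x∈p∪q⁻ ⁅ lb D j ⁆ S x∈S
  ... | inj₁ x∈⁅j⁆ = subst (λ y → _ ≤ toℕ y) (sym (x∈⁅y⁆⇒x≡y _ x∈⁅j⁆)) v≤j
  ... | inj₂ x∈S'  = support m (LabelsFrom-child (hi D j) (hi-ord D j) v≤j) x∈S'

  record Split (s : ℕ) (p : Ptr (k D)) (S : Subset n) : Set where
    field
      cut           : Ptr (k D)
      prefix suffix : Subset n
      path          : Path p cut prefix
      rest          : Mem D cut suffix
      decomposes    : S ≡ prefix ∪ suffix
      prefix-below  : ∀ x → x ∈ prefix → toℕ x < s
      suffix-above  : ∀ x → x ∈ suffix → s ≤ toℕ x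

  split-here : ∀ {s j S} → s ≤ toℕ (lb D j) → Mem D (node j) S → Split s (node j) S
  split-here {S = S} s≤j m = record
    { path = here ; rest = m ; decomposes = sym (∪-identityˡ S)
    ; prefix-below = λ _ x∈∅ → ⊥-elim (∉⊥ x∈∅) ; suffix-above = λ _ → support m s≤j }

  split : ∀ s {p S} → Mem D p S → Split s p S
  split s mem-top = record
    { path = here ; rest = mem-top ; decomposes = sym (∪-identityˡ ∅)
    ; prefix-below = λ _ x∈∅ → ⊥-elim (∉⊥ x∈∅)
    ; suffix-above = λ _ x∈∅ → ⊥-elim (∉⊥ x∈∅) }
  split s (mem-lo {j} m) with toℕ (lb D j) <? s
  ... | no  j≮s = split-here (≮⇒≥ j≮s) (mem-lo m)
  ... | yes _   = record
    { path = lo-step path ; rest = rest ; decomposes = decomposes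
    ; prefix-below = prefix-below ; suffix-above = suffix-above }
    where open Split (split s m)
  split s (mem-hi {j} {S} m) with toℕ (lb D j) <? s
  ... | no  j≮s = split-here (≮⇒≥ j≮s) (mem-hi m)
  ... | yes j<s = record
    { path = hi-step path ; rest = rest
    ; decomposes = trans (cong (⁅ lb D j ⁆ ∪_) decomposes) (sym (∪-assoc ⁅ lb D j ⁆ prefix suffix))
    ; prefix-below = below ; suffix-above = suffix-above }
    where
    open Split (split s m)
    below : ∀ x → x ∈ ⁅ lb D j ⁆ ∪ prefix → toℕ x < s
    below x x∈ with x∈p∪q⁻ ⁅ lb D j ⁆ prefix x∈
    ... | inj₁ x∈⁅j⁆ = subst (λ y → toℕ y < s) (sym (x∈⁅y⁆⇒x≡y _ x∈⁅j⁆)) j<s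
    ... | inj₂ x∈P  = prefix-below x x∈P

cut-and-paste : ∀ {s t} (D : ZDD (s + t)) {p u u' v v'}
  (sp : Paths.Split D s p (u ++ v)) (sp' : Paths.Split D s p (u' ++ v')) →
  Paths.Split.cut sp ≡ Paths.Split.cut sp' → Mem D p (u' ++ v)
cut-and-paste D {u' = u'} {v} sp sp' same-cut =
  subst (Mem D _) prefix'∪suffix≡u'++v (glue (path sp') (subst (λ q → Mem D q _) same-cut (rest sp)))
  where
  open Paths D
  open Split
  prefix'∪suffix≡u'++v : prefix sp' ∪ suffix sp ≡ u' ++ v
  prefix'∪suffix≡u'++v
    with prefix-suffix-++ (prefix sp) (suffix sp) (decomposes sp) (prefix-below sp) (suffix-above sp)
       | prefix-suffix-++ (prefix sp') (suffix sp') (decomposes sp') (prefix-below sp') (suffix-above sp')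
  ... | _ , suffix≡ | prefix'≡ , _ = trans (cong₂ _∪_ prefix'≡ suffix≡) (++∅-∪-∅++ u' v)

ptr-index : ∀ {k} → Ptr k → Fin (2 + k)
ptr-index bot      = Fin.zero
ptr-index top      = Fin.suc Fin.zero
ptr-index (node j) = Fin.suc (Fin.suc j)

ptr-index-injective : ∀ {k} → Injective _≡_ _≡_ (ptr-index {k})
ptr-index-injective {x = bot}    {bot}    _    = refl
ptr-index-injective {x = top}    {top}    _    = refl
ptr-index-injective {x = node i} {node j} refl = refl

bit : Fin 2 → Bool
bit Fin.zero    = false
bit (Fin.suc _) = true

bit-injective : Injective _≡_ _≡_ bit
bit-injective {Fin.zero}         {Fin.zero}         _ = refl
bit-injective {Fin.suc Fin.zero} {Fin.suc Fin.zero} _ = refl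

funToFin-cong : ∀ {m n} {f g : Fin m → Fin n} → f ≗ g → funToFin f ≡ funToFin g
funToFin-cong {zero}  _   = refl
funToFin-cong {suc m} f≗g = cong₂ combine (f≗g Fin.zero) (funToFin-cong (f≗g ∘ Fin.suc))

subset-code : ∀ {s} → Fin (2 ^ s) → Subset s
subset-code i = tabulate (bit ∘ finToFun i)

subset-code-injective : ∀ {s} → Injective _≡_ _≡_ (subset-code {s})
subset-code-injective {s} {i} {j} same-code = begin
  i                             ≡⟨ sym (funToFin-finToFin {s} {2} i) ⟩
  funToFin (finToFun {2} {s} i) ≡⟨ funToFin-cong (λ x → bit-injective (same-bit x)) ⟩
  funToFin (finToFun {2} {s} j) ≡⟨ funToFin-finToFin {s} {2} j ⟩
  j                             ∎
  where
  open ≡-Reasoning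
  same-bit : ∀ x → bit (finToFun i x) ≡ bit (finToFun j x)
  same-bit x = trans (sym (lookup∘tabulate _ x)) (trans (cong (λ c → lookup c x) same-code) (lookup∘tabulate _ x))

injection-bound : ∀ {s k} (f : Subset s → Ptr k) → Injective _≡_ _≡_ f → 2 ^ s ≤ k + 2
injection-bound {s} {k} f f-injective =
  subst (2 ^ s ≤_) (+-comm 2 k) (injective⇒≤ (subset-code-injective ∘ f-injective ∘ ptr-index-injective))

fooling-set-bound : ∀ {s t} (D : ZDD (s + t)) {F : Fam (s + t)} → Represents D F →
  (g : Subset s → Subset t) → (∀ a → F (a ++ g a)) → (∀ a a' → F (a' ++ g a) → a ≡ a') →
  2 ^ s ≤ size D
fooling-set-bound {s} D rep g diagonal off-diagonal = injection-bound cut cut-injective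
  where
  open Paths D
  split-diagonal : ∀ a → Split s (root D) (a ++ g a)
  split-diagonal a = split s (Equivalence.from (rep _) (diagonal a))
  cut : Subset s → Ptr (k D)
  cut a = Split.cut (split-diagonal a)
  cut-injective : Injective _≡_ _≡_ cut
  cut-injective {a} {a'} same-cut = off-diagonal a a'
    (Equivalence.to (rep _) (cut-and-paste D {u = a} {a'} {g a} {g a'} (split-diagonal a) (split-diagonal a') same-cut))

-- Tries

node-injective : ∀ {k} {i j : Fin k} → node i ≡ node j → i ≡ j
node-injective refl = refl

module Trie {m n : ℕ} (T : Fin m → Subset n) where
  open Equivalence

  Agree : ℕ → Fin m → Fin m → Set
  Agree x i j = ∀ y → toℕ y < x → lookup (T i) y ≡ lookup (T j) y

  agree? : ∀ x i j → Dec (Agree x i j)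
  agree? x i j = all? λ y → toℕ y <? x →-dec lookup (T i) y Bool.≟ lookup (T j) y

  agree-sym : ∀ {x i j} → Agree x i j → Agree x j i
  agree-sym agree y y<x = sym (agree y y<x)

  agree-trans : ∀ {x i j l} → Agree x i j → Agree x j l → Agree x i l
  agree-trans agree agree' y y<x = trans (agree y y<x) (agree' y y<x)

  agree-pred : ∀ {x i j} → Agree (suc x) i j → Agree x i j
  agree-pred agree y y<x = agree y (≤-trans y<x (n≤1+n _))

  agree-suc : ∀ {z i j} → Agree (toℕ z) i j → lookup (T i) z ≡ lookup (T j) z → Agree (suc (toℕ z)) i j
  agree-suc agree same-at-z y y≤z with m<1+n⇒m<n∨m≡n y≤z
  ... | inj₁ y<z = agree y y<z
  ... | inj₂ y≡z rewrite toℕ-injective y≡z = same-at-z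

  Slice : ℕ → Fin m → Subset n → Set
  Slice x j S = ∀ y → y ∈ S ⇔ (y ∈ T j × x ≤ toℕ y)

  -- The trie node (i , z) represents Level i (toℕ z): the parts at or above z of the sets that
  -- agree with T i below z.  Its children take any such set with the right bit at z as new index.
  Level : Fin m → ℕ → Subset n → Set
  Level i x S = ∃ λ j → Agree x i j × Slice x j S

  Branch : Bool → Fin m → Fin n → Fin m → Set
  Branch b i z j = Agree (toℕ z) i j × lookup (T j) z ≡ b

  branch? : ∀ b i z j → Dec (Branch b i z j)
  branch? b i z j = agree? (toℕ z) i j ×-dec lookup (T j) z Bool.≟ b

  at : Fin m → ℕ → Ptr (m * n)
  at i x with x <? n
  ... | yes x<n = node (combine i (fromℕ< x<n))
  ... | no  _   = top

  child : Bool → Fin m → Fin n → Ptr (m * n)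
  child b i z with any? (branch? b i z)
  ... | yes (j , _) = at j (suc (toℕ z))
  ... | no  _       = bot

  data ChildView (b : Bool) (i : Fin m) (z : Fin n) : Ptr (m * n) → Set where
    branch : ∀ j → Branch b i z j → ChildView b i z (at j (suc (toℕ z)))
    none   : (∀ j → ¬ Branch b i z j) → ChildView b i z bot

  child-view : ∀ b i z → ChildView b i z (child b i z)
  child-view b i z with any? (branch? b i z)
  ... | yes (j , br) = branch j br
  ... | no  ¬br      = none λ j br → ¬br (j , br)

  index : Fin (m * n) → Fin m
  index c = proj₁ (remQuot {m} n c)

  label : Fin (m * n) → Fin n
  label c = proj₂ (remQuot {m} n c)

  decode-combine : ∀ i z → remQuot {m} n (combine i z) ≡ (i , z)
  decode-combine = remQuot-combine

  label-combine : ∀ i z → label (combine i z) ≡ z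
  label-combine i z = cong proj₂ (decode-combine i z)

  at-label : ∀ j x {c} → at j x ≡ node c → toℕ (label c) ≡ x
  at-label j x at≡c with x <? n
  ... | yes x<n = trans (cong (toℕ ∘ label) (sym (node-injective at≡c)))
                        (trans (cong toℕ (label-combine j _)) (toℕ-fromℕ< x<n))

  child-label : ∀ b i z {c} → child b i z ≡ node c → toℕ (label c) ≡ suc (toℕ z)
  child-label b i z child≡c with child b i z | child-view b i z
  ... | _ | branch j _ = at-label j _ child≡c

  trie : Fin m → ZDD n
  trie i₀ = record
    { k      = m * n
    ; lb     = label
    ; lo     = λ c → child false (index c) (label c)
    ; hi     = λ c → child true  (index c) (label c)
    ; root   = at i₀ 0
    ; lo-ord = λ _ _ child≡c → ≤-reflexive (sym (child-label false _ _ child≡c))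
    ; hi-ord = λ _ _ child≡c → ≤-reflexive (sym (child-label true  _ _ child≡c))
    }

  Sem : Ptr (m * n) → Subset n → Set
  Sem bot      _ = ⊥
  Sem top      S = Empty S
  Sem (node c) S = Level (index c) (toℕ (label c)) S

  at-sound : ∀ j x {S} → Sem (at j x) S → Level j x S
  at-sound j x {S} sem with x <? n
  ... | yes x<n = subst₂ (λ i x → Level i x S) (cong proj₁ (decode-combine j _))
                    (trans (cong toℕ (label-combine j _)) (toℕ-fromℕ< x<n)) sem
  ... | no  x≮n = j , (λ _ _ → refl) , λ y → mk⇔ (λ y∈S → ⊥-elim (sem (y , y∈S)))
                                                (λ (_ , x≤y) → ⊥-elim (x≮n (≤-<-trans x≤y (toℕ<n y))))

  child-sound : ∀ b i z {S} → Sem (child b i z) S → ∃ λ j → Branch b i z j × Level j (suc (toℕ z)) S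
  child-sound b i z sem with child b i z | child-view b i z
  ... | _ | branch j br = j , br , at-sound j _ sem

  level-lo : ∀ {i z j S} → Branch false i z j → Level j (suc (toℕ z)) S → Level i (toℕ z) S
  level-lo {z = z} {S = S} (agree , bit) (l , agree' , slice) =
    l , agree-trans agree (agree-pred agree') , λ y → mk⇔ (Product.map₂ <⇒≤ ∘ to (slice y)) (back y)
    where
    z∉l : z ∉ T l
    z∉l = lookup-∉ (trans (sym (agree' z ≤-refl)) bit)
    back : ∀ y → y ∈ T l × toℕ z ≤ toℕ y → y ∈ S
    back y (y∈l , z≤y) with m≤n⇒m<n∨m≡n z≤y
    ... | inj₁ z<y = from (slice y) (y∈l , z<y)
    ... | inj₂ z≡y = ⊥-elim (z∉l (subst (_∈ T l) (toℕ-injective (sym z≡y)) y∈l))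

  level-hi : ∀ {i z j S} → Branch true i z j → Level j (suc (toℕ z)) S → Level i (toℕ z) (⁅ z ⁆ ∪ S)
  level-hi {z = z} {S = S} (agree , bit) (l , agree' , slice) =
    l , agree-trans agree (agree-pred agree') , λ y → mk⇔ (forth y) (back y)
    where
    z∈l : z ∈ T l
    z∈l = lookup⇒[]= _ _ (trans (sym (agree' z ≤-refl)) bit)
    forth : ∀ y → y ∈ ⁅ z ⁆ ∪ S → y ∈ T l × toℕ z ≤ toℕ y
    forth y y∈ with x∈p∪q⁻ ⁅ z ⁆ S y∈
    ... | inj₁ y∈⁅z⁆ rewrite x∈⁅y⁆⇒x≡y z y∈⁅z⁆ = z∈l , ≤-refl
    ... | inj₂ y∈S   = Product.map₂ <⇒≤ (to (slice y) y∈S)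
    back : ∀ y → y ∈ T l × toℕ z ≤ toℕ y → y ∈ ⁅ z ⁆ ∪ S
    back y (y∈l , z≤y) with m≤n⇒m<n∨m≡n z≤y
    ... | inj₁ z<y = x∈p∪q⁺ (inj₂ (from (slice y) (y∈l , z<y)))
    ... | inj₂ z≡y rewrite toℕ-injective {i = z} {j = y} z≡y = x∈p∪q⁺ (inj₁ (x∈⁅x⁆ y))

  slice-skip : ∀ {z j S} → z ∉ T j → Slice (toℕ z) j S → Slice (suc (toℕ z)) j S
  slice-skip {z} {j} {S} z∉j slice y = mk⇔ forth (λ (y∈j , z<y) → from (slice y) (y∈j , <⇒≤ z<y))
    where
    forth : y ∈ S → y ∈ T j × toℕ z < toℕ y
    forth y∈S with to (slice y) y∈S
    ... | y∈j , z≤y = y∈j , ≤∧≢⇒< z≤y λ z≡y →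
                        z∉j (subst (_∈ T j) (toℕ-injective (sym z≡y)) y∈j)

  slice-remove : ∀ {z j S} → Slice (toℕ z) j S → Slice (suc (toℕ z)) j (S - z)
  slice-remove {z} {j} {S} slice y = mk⇔ forth back
    where
    forth : y ∈ S - z → y ∈ T j × toℕ z < toℕ y
    forth y∈S-z with to (slice y) (p─q⊆p S ⁅ z ⁆ y∈S-z)
    ... | y∈j , z≤y = y∈j , ≤∧≢⇒< z≤y λ z≡y →
                        x∉p-x S z (subst (_∈ S - z) (toℕ-injective (sym z≡y)) y∈S-z)
    back : y ∈ T j × toℕ z < toℕ y → y ∈ S - z
    back (y∈j , z<y) =
      x∈p∧x≢y⇒x∈p-y (from (slice y) (y∈j , <⇒≤ z<y)) λ y≡z → <-irrefl (cong toℕ (sym y≡z)) z<y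

  slice-beyond : ∀ {x j S} → ¬ x < n → Slice x j S → S ≡ ∅
  slice-beyond x≮n slice =
    Empty-unique λ (y , y∈S) → x≮n (≤-<-trans (proj₂ (to (slice y) y∈S)) (toℕ<n y))

  module _ (i₀ : Fin m) where

    sound : ∀ {p S} → Mem (trie i₀) p S → Sem p S
    sound mem-top (_ , x∈∅) = ∉⊥ x∈∅
    sound (mem-lo mem) with child-sound false _ _ (sound mem)
    ... | _ , br , level = level-lo br level
    sound (mem-hi mem) with child-sound true _ _ (sound mem)
    ... | _ , br , level = level-hi br level

    node-lo : ∀ {i z S} → Mem (trie i₀) (child false i z) S → Mem (trie i₀) (node (combine i z)) S
    node-lo {i} {z} {S} mem =
      mem-lo (subst (λ (i' , z') → Mem (trie i₀) (child false i' z') S) (sym (decode-combine i z)) mem)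

    node-hi : ∀ {i z S} → Mem (trie i₀) (child true i z) S →
              Mem (trie i₀) (node (combine i z)) (⁅ z ⁆ ∪ S)
    node-hi {i} {z} {S} mem =
      subst (λ z' → Mem (trie i₀) (node (combine i z)) (⁅ z' ⁆ ∪ S)) (label-combine i z)
        (mem-hi (subst (λ (i' , z') → Mem (trie i₀) (child true i' z') S) (sym (decode-combine i z)) mem))

    child-complete : ∀ b i z j → Branch b i z j → ∀ {S} →
      (∀ l → Agree (suc (toℕ z)) l j → Mem (trie i₀) (at l (suc (toℕ z))) S) →
      Mem (trie i₀) (child b i z) S
    child-complete b i z j (agree , bit) continue with child b i z | child-view b i z
    ... | _ | branch l (agree' , bit') =
      continue l (agree-suc (agree-trans (agree-sym agree') agree) (trans bit' (sym bit)))
    ... | _ | none ¬branch = ⊥-elim (¬branch j (agree , bit))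

    complete : ∀ d {x i j S} → x + d ≡ n → Agree x i j → Slice x j S → Mem (trie i₀) (at i x) S
    complete d {x} x+d≡n agree slice with x <? n
    complete d       {x} _     _     slice | no x≮n =
      subst (Mem (trie i₀) top) (sym (slice-beyond x≮n slice)) mem-top
    complete zero    {x} x+0≡n _     _     | yes x<n =
      ⊥-elim (<-irrefl (trans (sym (+-identityʳ x)) x+0≡n) x<n)
    complete (suc d) {x} {i} {j} {S} x+d≡n agree slice | yes x<n with fromℕ< x<n | toℕ-fromℕ< x<n
    ... | z | refl with lookup (T j) z in bit
    ... | false = node-lo (child-complete false i z j (agree , bit) λ _ agree' →
                    complete d (trans (sym (+-suc x d)) x+d≡n) agree' (slice-skip (lookup-∉ bit) slice))
    ... | true  = subst (Mem (trie i₀) (node (combine i z))) (⁅x⁆∪[p-x]≡p z∈S)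
                    (node-hi (child-complete true i z j (agree , bit) λ _ agree' →
                      complete d (trans (sym (+-suc x d)) x+d≡n) agree' (slice-remove slice)))
      where
      z∈S : z ∈ S
      z∈S = from (slice z) (lookup⇒[]= _ _ bit , ≤-refl)

  represents : ∀ i₀ → Represents (trie i₀) (λ S → ∃ λ j → S ≡ T j)
  represents i₀ S = mk⇔ (level-zero ∘ at-sound i₀ 0 ∘ sound i₀) λ (j , S≡Tj) →
    subst (Mem (trie i₀) (at i₀ 0)) (sym S≡Tj) (complete i₀ n refl (λ _ ()) λ y → mk⇔ (_, z≤n) proj₁)
    where
    level-zero : ∀ {i S} → Level i 0 S → ∃ λ j → S ≡ T j
    level-zero (j , _ , slice) = j , ⊆-antisym (proj₁ ∘ to (slice _)) (λ y∈Tj → from (slice _) (y∈Tj , z≤n))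

-- The two families

double : ∀ {M} → Subset M → Subset (M + M)
double u = u ++ u

generator : Op → ∀ M → Fin M → Subset (M + M)
generator sharp   M j = double ⁅ j ⁆
generator closure M j = double (∁ ⁅ j ⁆)

family : Op → ∀ M → Fam (M + M)
family op M S = ∃ λ j → S ≡ generator op M j

module _ {M : ℕ} where

  hits-pairs⁺ : ∀ {u v : Subset M} → (∀ j → j ∈ u ⊎ j ∈ v) → Hits (family sharp M) (u ++ v)
  hits-pairs⁺ {u} {v} covers _ (j , refl) with covers j
  ... | inj₁ j∈u = j ↑ˡ M , x∈p∩q⁺ (∈-++⁺ˡ v j∈u , ∈-++⁺ˡ ⁅ j ⁆ (x∈⁅x⁆ j))
  ... | inj₂ j∈v = M ↑ʳ j , x∈p∩q⁺ (∈-++⁺ʳ u j∈v , ∈-++⁺ʳ ⁅ j ⁆ (x∈⁅x⁆ j))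

  hits-pairs⁻ : ∀ {u v : Subset M} → Hits (family sharp M) (u ++ v) → ∀ j → j ∈ u ⊎ j ∈ v
  hits-pairs⁻ {u} {v} hits j = Sum.map Nonempty-∩⁅⁆ Nonempty-∩⁅⁆
    (Nonempty-++⁻ (u ∩ ⁅ j ⁆) (subst Nonempty (∩-++ u ⁅ j ⁆ v ⁅ j ⁆) (hits _ (j , refl))))

  sharp-diagonal : ∀ a → MinHit (family sharp M) (a ++ ∁ a)
  sharp-diagonal a = hits-pairs⁺ a-or-∁a , minimal
    where
    a-or-∁a : ∀ j → j ∈ a ⊎ j ∈ ∁ a
    a-or-∁a j with j ∈? a
    ... | yes j∈a = inj₁ j∈a
    ... | no  j∉a = inj₂ (x∉p⇒x∈∁p j∉a)
    minimal : ∀ S → Hits (family sharp M) S → S ⊆ a ++ ∁ a → a ++ ∁ a ≡ S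
    minimal S hits S⊆ with splitAt M S
    ... | u , v , refl = cong₂ _++_ (⊆-antisym a⊆u u⊆a) (⊆-antisym ∁a⊆v v⊆∁a)
      where
      u⊆a = proj₁ (⊆-++⁻ S⊆)
      v⊆∁a = proj₂ (⊆-++⁻ S⊆)
      a⊆u : a ⊆ u
      a⊆u {j} j∈a with hits-pairs⁻ hits j
      ... | inj₁ j∈u = j∈u
      ... | inj₂ j∈v = ⊥-elim (x∈∁p⇒x∉p (v⊆∁a j∈v) j∈a)
      ∁a⊆v : ∁ a ⊆ v
      ∁a⊆v {j} j∈∁a with hits-pairs⁻ hits j
      ... | inj₁ j∈u = ⊥-elim (x∈∁p⇒x∉p j∈∁a (u⊆a j∈u))
      ... | inj₂ j∈v = j∈v

  -- If a' has j but a does not, then a' ++ ∁ a still hits every pair after dropping X_j.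
  sharp-off-diagonal : ∀ a a' → MinHit (family sharp M) (a' ++ ∁ a) → a ≡ a'
  sharp-off-diagonal a a' (hits , minimal) = ⊆-antisym a⊆a' a'⊆a
    where
    covers = hits-pairs⁻ hits
    a⊆a' : a ⊆ a'
    a⊆a' {j} j∈a with covers j
    ... | inj₁ j∈a' = j∈a'
    ... | inj₂ j∈∁a = ⊥-elim (x∈∁p⇒x∉p j∈∁a j∈a)
    a'⊆a : a' ⊆ a
    a'⊆a {j} j∈a' = decidable-stable (j ∈? a) λ j∉a → x∉p-x a' j (subst (j ∈_) (a'≡a'-j j∉a) j∈a')
      where
      covers-without : j ∉ a → ∀ l → l ∈ a' - j ⊎ l ∈ ∁ a
      covers-without j∉a l with covers l
      ... | inj₂ l∈∁a = inj₂ l∈∁a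
      ... | inj₁ l∈a' with l Fin.≟ j
      ...   | yes refl = inj₂ (x∉p⇒x∈∁p j∉a)
      ...   | no  l≢j  = inj₁ (x∈p∧x≢y⇒x∈p-y l∈a' l≢j)
      a'≡a'-j : j ∉ a → a' ≡ a' - j
      a'≡a'-j j∉a = ++-injectiveˡ a' (a' - j)
        (minimal _ (hits-pairs⁺ (covers-without j∉a)) (⊆-++⁺ (p─q⊆p a' ⁅ j ⁆) ⊆-refl))

  ⋂-double : ∀ (L : List (Subset M)) → ⋂ (map double L) ≡ double (⋂ L)
  ⋂-double List.[]      = replicate-++ M true
  ⋂-double (u List.∷ L) = trans (cong (double u ∩_) (⋂-double L)) (∩-++ u (⋂ L) u (⋂ L))

  ⋂-co-singletons : ∀ a → ⋂ (map (∁ ∘ ⁅_⁆) (filter (λ j → ¬? (j ∈? a)) (allFin M))) ≡ a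
  ⋂-co-singletons a = ⊆-antisym ⋂⊆a a⊆⋂
    where
    ∉a? = λ j → ¬? (j ∈? a)
    ⋂⊆a : ⋂ (map (∁ ∘ ⁅_⁆) (filter ∉a? (allFin M))) ⊆ a
    ⋂⊆a {x} x∈⋂ = decidable-stable (x ∈? a) λ x∉a →
      x∈∁p⇒x∉p (All.lookup (map⁻ (∈-⋂⁻ _ x∈⋂)) (∈-filter⁺ ∉a? (∈-allFin x) x∉a))
               (x∈⁅x⁆ x)
    a⊆⋂ : a ⊆ ⋂ (map (∁ ∘ ⁅_⁆) (filter ∉a? (allFin M)))
    a⊆⋂ {x} x∈a = ∈-⋂⁺ (map⁺ (All.map x∈∁⁅j⁆ (all-filter ∉a? (allFin M))))
      where
      x∈∁⁅j⁆ : ∀ {j} → j ∉ a → x ∈ ∁ ⁅ j ⁆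
      x∈∁⁅j⁆ j∉a = x∉p⇒x∈∁p (x≢y⇒x∉⁅y⁆ λ x≡j → j∉a (subst (_∈ a) x≡j x∈a))

  closure-diagonal : ∀ a → Closure (family closure M) (a ++ a)
  closure-diagonal a =
    map double co-singletons , generated , sym (trans (⋂-double co-singletons) (cong double (⋂-co-singletons a)))
    where
    outside-a = filter (λ j → ¬? (j ∈? a)) (allFin M)
    co-singletons = map (∁ ∘ ⁅_⁆) outside-a
    generated : All (family closure M) (map double co-singletons)
    generated = map⁺ (map⁺ (All.universal {P = λ j → family closure M (generator closure M j)}
                                          (λ j → j , refl) outside-a))

  closure-off-diagonal : ∀ a a' → Closure (family closure M) (a' ++ a) → a ≡ a'
  closure-off-diagonal a a' closed
    with closure-induction (λ S → ∃ λ u → S ≡ double u) (⊤ₛ , replicate-++ M true)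
           (λ { (u , refl) (v , refl) → u ∩ v , ∩-++ u v u v })
           (λ { (j , refl) → ∁ ⁅ j ⁆ , refl }) closed
  ... | u , a'++a≡u++u with ++-injective a' u a'++a≡u++u
  ... | refl , refl = refl

ground-bound : ∀ m → 1 ≤ m → m + m ≤ 2 * m ^ 2
ground-bound m@(suc _) _ = begin
  m + m      ≡⟨ doubled m ⟩
  2 * m ^ 1  ≤⟨ *-monoʳ-≤ 2 (^-monoʳ-≤ m {1} {2} (s≤s z≤n)) ⟩
  2 * m ^ 2  ∎
  where
  open ≤-Reasoning
  doubled : ∀ m → m + m ≡ 2 * (m * 1)
  doubled = solve-∀

trie-bound : ∀ op m → 1 ≤ m → Σ (ZDD (m + m)) λ D → Represents D (family op m) × size D ≤ 4 * m ^ 4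
trie-bound op m@(suc _) _ = trie Fin.zero , represents Fin.zero , size-bound
  where
  open Trie (generator op m)
  open ≤-Reasoning
  -- powers are unfolded because the ring solver does not handle _^_
  as-powers : ∀ m → m * (m + m) + 2 ≡ 2 * (m * (m * 1)) + 2 * 1
  as-powers = solve-∀
  twice : ∀ m → 2 * (m * (m * (m * (m * 1)))) + 2 * (m * (m * (m * (m * 1)))) ≡ 4 * (m * (m * (m * (m * 1))))
  twice = solve-∀
  size-bound : m * (m + m) + 2 ≤ 4 * m ^ 4
  size-bound = begin
    m * (m + m) + 2        ≡⟨ as-powers m ⟩
    2 * m ^ 2 + 2 * m ^ 0  ≤⟨ +-mono-≤ (*-monoʳ-≤ 2 (^-monoʳ-≤ m {2} {4} (s≤s (s≤s z≤n))))
                                      (*-monoʳ-≤ 2 (^-monoʳ-≤ m {0} {4} z≤n)) ⟩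
    2 * m ^ 4 + 2 * m ^ 4  ≡⟨ twice m ⟩
    4 * m ^ 4              ∎

fooling-bound : ∀ op m (D : ZDD (m + m)) → Represents D (apply op (family op m)) → 2 ^ m ≤ size D
fooling-bound sharp   m D rep = fooling-set-bound D rep ∁ sharp-diagonal sharp-off-diagonal
fooling-bound closure m D rep = fooling-set-bound D rep (λ a → a) closure-diagonal closure-off-diagonal

theorem12 : (op : Op) →
    Σ (ℕ → ℕ) λ n → Σ ((m : ℕ) → Fam (n m)) λ F →
    Σ ℕ λ m₀ → Σ ℕ λ c₁ → Σ ℕ λ c₂ → Σ ℕ λ c₃ → Σ ℕ λ d →
      (∀ m → 1 ≤ m → m₀ ≤ m → n m ≤ c₁ * m ^ 2)
      × (∀ m → 1 ≤ m → m₀ ≤ m →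
           Σ (ZDD (n m)) λ D → Represents D (F m) × size D ≤ c₂ * m ^ 4)
      × (∀ m → 1 ≤ m → m₀ ≤ m → (D : ZDD (n m)) →
           Represents D (apply op (F m)) → 2 ^ m ≤ size D * (c₃ * m ^ d))
theorem12 op =
  (λ m → m + m) , family op , 1 , 2 , 4 , 1 , 0 ,
  (λ m 1≤m _ → ground-bound m 1≤m) ,
  (λ m 1≤m _ → trie-bound op m 1≤m) ,
  (λ m _ _ D rep → subst (2 ^ m ≤_) (sym (*-identityʳ (size D))) (fooling-bound op m D rep))
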